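{- Let $m\ge 2$ be an integer and let $G$ be a graph in the family $\mathcal{T}_m$. Then $\gamma_{3{\rm rt}}(G)=\frac{3}{2}\gamma(G)$.
   Context: All graphs are finite, simple and undirected; $N(v)$ denotes the open neighborhood of $v$, and $[k]=\{1,\dots,k\}$. $\gamma(G)$ is the domination number. A $k$-rainbow total dominating function ($k$RTDF) of $G$ is a function $f:V(G)\to 2^{[k]}$ such that (i) every vertex $v$ with $f(v)=\emptyset$ satisfies $\bigcup_{u\in N(v)}f(u)=[k]$, and (ii) for every vertex $v$ with $f(v)=\{i\}$ there is $u\in N(v)$ with $i\in f(u)$; its weight is $\|f\|=\sum_v|f(v)|$ and $\gamma_{k{\rm rt}}(G)$ is the minimum weight of a $k$RTDF. The family $\mathcal{T}_m$: a graph $G$ is in $\mathcal{T}_m$ if it is constructed as follows. Take three vertex-disjoint graphs $H_1,H_2,H_3$, each consisting of $m$ disjoint edges. For each triple $\bar x=(x_1,x_2,x_3)$ with $x_i\in V(H_i)$, add a new independent set $I_{\bar x}$ of size at least $m$ (these sets pairwise disjoint and disjoint from the $H_i$), and join each of $x_1,x_2,x_3$ to every vertex of $I_{\bar x}$. There are no other edges. -}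

module Defs where

open import Data.Nat using (ℕ; _≤_; _*_)
open import Data.Fin using (Fin; zero; suc)
open import Data.Fin.Subset using (Subset; ⊥; ⁅_⁆; _∈_; ∣_∣)
open import Data.Vec using (sum; tabulate)
open import Data.Product using (Σ; ∃; _×_; _,_)
open import Data.Sum using (_⊎_; inj₁; inj₂)
open import Data.Empty renaming (⊥ to Empty)
open import Relation.Nullary using (¬_)
open import Relation.Binary.PropositionalEquality using (_≡_; _≢_)
open import Function.Bundles using (_⇔_)
open import Function.Definitions using (Bijective)

record Graph (n : ℕ) : Set₁ where
  field
    Adj    : Fin n → Fin n → Set
    sym    : ∀ {u v} → Adj u v → Adj v u
    irrefl : ∀ {v} → ¬ Adj v v
open Graph public

Σv : ∀ {n} → (Fin n → ℕ) → ℕ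
Σv f = sum (tabulate f)

Dominating : ∀ {n} → Graph n → Subset n → Set
Dominating {n} G D = ∀ (v : Fin n) → v ∈ D ⊎ ∃ λ u → Adj G v u × u ∈ D

IsDominationNumber : ∀ {n} → Graph n → ℕ → Set
IsDominationNumber G k =
  (∃ λ D → Dominating G D × ∣ D ∣ ≡ k) ×
  (∀ D → Dominating G D → k ≤ ∣ D ∣)

IsRTDF : ∀ {n} (k : ℕ) → Graph n → (Fin n → Subset k) → Set
IsRTDF {n} k G f =
  (∀ (v : Fin n) → f v ≡ ⊥ → ∀ (i : Fin k) → ∃ λ u → Adj G v u × i ∈ f u) ×
  (∀ (v : Fin n) (i : Fin k) → f v ≡ ⁅ i ⁆ → ∃ λ u → Adj G v u × i ∈ f u)

weight : ∀ {n k} → (Fin n → Subset k) → ℕ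
weight f = Σv (λ v → ∣ f v ∣)

IsRTDNumber : ∀ {n} (k : ℕ) → Graph n → ℕ → Set
IsRTDNumber k G r =
  (∃ λ f → IsRTDF k G f × weight f ≡ r) ×
  (∀ f → IsRTDF k G f → r ≤ weight f)

-- The family T_m
-- H_i (i ∈ Fin 3) has vertices (j , b), j ∈ Fin m (the j-th edge), b ∈ Fin 2 (endpoint).

HVertex : ℕ → Set
HVertex m = Fin 3 × Fin m × Fin 2

-- A triple x̄ = (x₁,x₂,x₃) with xᵢ ∈ V(Hᵢ) (a first-order product, so that
-- equality of triples is componentwise without function extensionality).
Triple : ℕ → Set
Triple m = (Fin m × Fin 2) × (Fin m × Fin 2) × (Fin m × Fin 2)

comp : ∀ {m} → Triple m → Fin 3 → Fin m × Fin 2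
comp (x₁ , x₂ , x₃) zero = x₁
comp (x₁ , x₂ , x₃) (suc zero) = x₂
comp (x₁ , x₂ , x₃) (suc (suc zero)) = x₃

-- Vertex set of the construction, with |I_x̄| = s x̄.
TVertex : (m : ℕ) → (Triple m → ℕ) → Set
TVertex m s = HVertex m ⊎ Σ (Triple m) (λ x → Fin (s x))

TAdj : ∀ {m s} → TVertex m s → TVertex m s → Set
TAdj (inj₁ (i , j , b)) (inj₁ (i' , j' , b')) = i ≡ i' × j ≡ j' × b ≢ b'
TAdj (inj₁ (i , j , b)) (inj₂ (x , _)) = comp x i ≡ (j , b)
TAdj (inj₂ (x , _)) (inj₁ (i , j , b)) = comp x i ≡ (j , b)
TAdj (inj₂ _) (inj₂ _) = Empty

InT : ∀ {n} → ℕ → Graph n → Set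
InT {n} m G =
  Σ (Triple m → ℕ) λ s →
    (∀ x → m ≤ s x) ×
    Σ (TVertex m s → Fin n) λ φ →
      Bijective _≡_ _≡_ φ ×
      (∀ a b → TAdj a b ⇔ Adj G (φ a) (φ b))

-- The upper bounds are explicit: V(H₁) together with one endpoint of every
-- edge of H₂ and H₃ dominates (4m vertices), and f(v) = {i} on V(Hᵢ),
-- f = ∅ on the I-sets is a 3RTDF (weight 6m).
-- The lower bounds are discharging arguments. For a vertex p of Hᵢ its
-- I-load is the weight sitting on the I-sets of the triples having p in
-- slot i; summing the I-loads over V(Hᵢ) counts every I-vertex exactly once.
-- Along each edge ab of Hᵢ a local count gives
--   2δ(a)+L(a)+2δ(b)+L(b) ≥ 2   and   3|f(a)|+L(a)+3|f(b)|+L(b) ≥ 6,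
-- hence 2dᵢ + X ≥ 2m and 3dᵢ + X ≥ 6m (dᵢ: weight on Hᵢ, X: weight on the
-- I-sets). Averaging over i gives the rainbow bound. For domination, either
-- some Hᵢ lies inside D (dᵢ = 2m, average the other two), or every Hᵢ has a
-- vertex outside D; then every vertex p ∉ D of Hᵢ lies on a triple whose
-- I-set (of size ≥ m ≥ 2) is forced into D, so 2dᵢ + X ≥ 4m.
module Submission where

open import Defs hiding (sym)
open import Data.Nat using (ℕ; zero; suc; _+_; _*_; _≤_; z≤n; s≤s)
open import Data.Nat.Properties
  using (≤-trans; ≤-reflexive; ≤-antisym; +-mono-≤; +-monoˡ-≤; +-monoʳ-≤; *-monoʳ-≤; *-cancelˡ-≤;
         m≤m+n; m≤n+m; +-comm; +-assoc; +-identityʳ; *-identityʳ; *-zeroʳ;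
         *-distribˡ-+; +-0-commutativeMonoid; +-commutativeSemigroup)
open import Data.Nat.Tactic.RingSolver using (solve-∀)
open import Data.Bool using (Bool; true; false)
open import Data.Fin using (Fin; zero; suc; _↑ˡ_; _↑ʳ_; splitAt; _≟_)
open import Data.Fin.Properties using (splitAt-↑ˡ; splitAt-↑ʳ; join-splitAt)
open import Data.Fin.Subset using (Subset; ⊥; ⊤; ⁅_⁆; ∁; _∈_; ∣_∣)
open import Data.Fin.Subset.Properties using (∉⊥; x∈⁅x⁆; ∣⁅x⁆∣≡1; x∈∁p⇒x∉p)
open import Data.Vec using ([]; _∷_; lookup; tabulate)
open import Data.Vec.Properties using ([]=⇒lookup; lookup⇒[]=; lookup∘tabulate)
open import Data.Vec.Functional using (updateAt)
open import Data.Vec.Functional.Properties using (updateAt-updates; updateAt-minimal)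
open import Data.Product using (Σ; ∃; ∃₂; _×_; _,_; proj₁; proj₂)
open import Data.Sum using (_⊎_; inj₁; inj₂; [_,_]; swap) renaming (map to ⊎-map)
open import Data.Empty using (⊥-elim)
open import Function using (_∘_; id)
open import Function.Bundles using (Equivalence; _⇔_)
open import Function.Definitions using (Bijective)
open import Relation.Binary.PropositionalEquality hiding ([_])
open import Relation.Nullary using (yes; no)
import Data.Fin.Permutation as Perm
import Algebra.Properties.CommutativeMonoid.Sum as MonoidSum
import Algebra.Properties.CommutativeSemigroup as SemigroupProperties

Σ-cong : ∀ {k} {f g : Fin k → ℕ} → (∀ i → f i ≡ g i) → Σv f ≡ Σv g
Σ-cong {zero}  e = refl
Σ-cong {suc k} e = cong₂ _+_ (e zero) (Σ-cong (e ∘ suc))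

Σ-mono : ∀ {k} {f g : Fin k → ℕ} → (∀ i → f i ≤ g i) → Σv f ≤ Σv g
Σ-mono {zero}  e = z≤n
Σ-mono {suc k} e = +-mono-≤ (e zero) (Σ-mono (e ∘ suc))

Σ-+ : ∀ {k} (f g : Fin k → ℕ) → Σv (λ i → f i + g i) ≡ Σv f + Σv g
Σ-+ {zero}  f g = refl
Σ-+ {suc k} f g =
  trans (cong (f zero + g zero +_) (Σ-+ (f ∘ suc) (g ∘ suc)))
        (SemigroupProperties.interchange +-commutativeSemigroup (f zero) (g zero) _ _)

Σ-* : ∀ {k} (c : ℕ) (f : Fin k → ℕ) → Σv (λ i → c * f i) ≡ c * Σv f
Σ-* {zero}  c f = sym (*-zeroʳ c)
Σ-* {suc k} c f = trans (cong (c * f zero +_) (Σ-* c (f ∘ suc))) (sym (*-distribˡ-+ c (f zero) _))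

Σ-const : ∀ {k} (c : ℕ) → Σv {k} (λ _ → c) ≡ k * c
Σ-const {zero}  c = refl
Σ-const {suc k} c = cong (c +_) (Σ-const {k} c)

Σ-zero : ∀ k → Σv {k} (λ _ → 0) ≡ 0
Σ-zero k = trans (Σ-const {k} 0) (*-zeroʳ k)

Σ-single : ∀ {k} (f : Fin k → ℕ) (i : Fin k) → f i ≤ Σv f
Σ-single f zero    = m≤m+n _ _
Σ-single f (suc i) = ≤-trans (Σ-single (f ∘ suc) i) (m≤n+m _ (f zero))

Σ-swap : ∀ {a b} (f : Fin a → Fin b → ℕ) →
         Σv (λ i → Σv (λ j → f i j)) ≡ Σv (λ j → Σv (λ i → f i j))
Σ-swap {zero}  {b} f = sym (Σ-zero b)
Σ-swap {suc a}     f =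
  trans (cong (Σv (f zero) +_) (Σ-swap (f ∘ suc)))
        (sym (Σ-+ (f zero) (λ j → Σv (λ i → f (suc i) j))))

Σ-++ : ∀ a {b} (f : Fin (a + b) → ℕ) →
       Σv f ≡ Σv (λ i → f (i ↑ˡ b)) + Σv (λ j → f (a ↑ʳ j))
Σ-++ zero    f = refl
Σ-++ (suc a) f =
  trans (cong (f zero +_) (Σ-++ a (f ∘ suc)))
        (sym (+-assoc (f zero) _ _))

averaging : ∀ k (a : Fin (suc k) → ℕ) {X c : ℕ} →
            (∀ i → c ≤ suc k * a i + X) → c ≤ Σv a + X
averaging k a {X} {c} bound = *-cancelˡ-≤ (suc k) (begin
  suc k * c                                     ≡⟨ Σ-const {suc k} c ⟨
  Σv {suc k} (λ _ → c)                          ≤⟨ Σ-mono bound ⟩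
  Σv (λ i → suc k * a i + X)                    ≡⟨ Σ-+ (λ i → suc k * a i) (λ _ → X) ⟩
  Σv (λ i → suc k * a i) + Σv {suc k} (λ _ → X) ≡⟨ cong₂ _+_ (Σ-* (suc k) a) (Σ-const {suc k} X) ⟩
  suc k * Σv a + suc k * X                      ≡⟨ *-distribˡ-+ (suc k) (Σv a) X ⟨
  suc k * (Σv a + X)                            ∎)
  where open Data.Nat.Properties.≤-Reasoning

averaging₂ : ∀ {a b X c : ℕ} → c ≤ 2 * a + X → c ≤ 2 * b + X → c ≤ a + b + X
averaging₂ {a} {b} {X} {c} ha hb =
  subst (λ y → c ≤ y + X) (cong (a +_) (+-identityʳ b))
        (averaging 1 (λ { zero → a ; (suc zero) → b }) λ { zero → ha ; (suc zero) → hb })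

Σ3-split : ∀ (d : Fin 3 → ℕ) i → ∃₂ λ j k → Σv d ≡ d i + (d j + d k)
Σ3-split d zero             =
  suc zero , suc (suc zero) , rearrange₀ (d zero) (d (suc zero)) (d (suc (suc zero)))
  where
  rearrange₀ : ∀ a b c → a + (b + (c + 0)) ≡ a + (b + c)
  rearrange₀ = solve-∀
Σ3-split d (suc zero)       =
  zero , suc (suc zero) , rearrange₁ (d zero) (d (suc zero)) (d (suc (suc zero)))
  where
  rearrange₁ : ∀ a b c → a + (b + (c + 0)) ≡ b + (a + c)
  rearrange₁ = solve-∀
Σ3-split d (suc (suc zero)) =
  zero , suc zero , rearrange₂ (d zero) (d (suc zero)) (d (suc (suc zero)))
  where
  rearrange₂ : ∀ a b c → a + (b + (c + 0)) ≡ c + (a + b)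
  rearrange₂ = solve-∀

all-or-counterexample : ∀ {k} {P Q : Fin k → Set} → (∀ i → P i ⊎ Q i) → (∀ i → P i) ⊎ ∃ Q
all-or-counterexample {zero}  d = inj₁ λ ()
all-or-counterexample {suc k} d with d zero | all-or-counterexample (d ∘ suc)
... | inj₂ q₀ | _             = inj₂ (zero , q₀)
... | inj₁ p₀ | inj₂ (i , qᵢ) = inj₂ (suc i , qᵢ)
... | inj₁ p₀ | inj₁ ps       = inj₁ λ { zero → p₀ ; (suc i) → ps i }

-- An enumeration of A: a bijection with Fin size. Sums over A are taken
-- along an enumeration; by ΣE-unique the choice does not matter.
record Enum (A : Set) : Set where
  field
    size       : ℕ
    enum       : Fin size → A
    index      : A → Fin size
    enum-index : ∀ a → enum (index a) ≡ a
    index-enum : ∀ i → index (enum i) ≡ i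
open Enum

ΣE : ∀ {A} → Enum A → (A → ℕ) → ℕ
ΣE E g = Σv (g ∘ enum E)

ΣE-cong : ∀ {A} (E : Enum A) {f g : A → ℕ} → (∀ a → f a ≡ g a) → ΣE E f ≡ ΣE E g
ΣE-cong E e = Σ-cong (e ∘ enum E)

ΣE-+ : ∀ {A} (E : Enum A) (f g : A → ℕ) → ΣE E (λ a → f a + g a) ≡ ΣE E f + ΣE E g
ΣE-+ E f g = Σ-+ (f ∘ enum E) (g ∘ enum E)

ΣE-* : ∀ {A} (E : Enum A) (c : ℕ) (f : A → ℕ) → ΣE E (λ a → c * f a) ≡ c * ΣE E f
ΣE-* E c f = Σ-* c (f ∘ enum E)

ΣE-zero : ∀ {A} (E : Enum A) → ΣE E (λ _ → 0) ≡ 0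
ΣE-zero E = Σ-zero (size E)

ΣE-single : ∀ {A} (E : Enum A) (f : A → ℕ) (a : A) → f a ≤ ΣE E f
ΣE-single E f a = subst (λ b → f b ≤ ΣE E f) (enum-index E a) (Σ-single (f ∘ enum E) (index E a))

ΣE-swap : ∀ {A B} (E : Enum A) (E' : Enum B) (f : A → B → ℕ) →
          ΣE E (λ a → ΣE E' (f a)) ≡ ΣE E' (λ b → ΣE E (λ a → f a b))
ΣE-swap E E' f = Σ-swap (λ i j → f (enum E i) (enum E' j))

ΣE-unique : ∀ {A} (E E' : Enum A) (g : A → ℕ) → ΣE E g ≡ ΣE E' g
ΣE-unique E E' g = begin
  Σv (g ∘ enum E)                          ≡⟨ sum≡Σv (g ∘ enum E) ⟨
  Sum.sum (g ∘ enum E)                     ≡⟨ Sum.sum-permute (g ∘ enum E) π ⟩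
  Sum.sum (g ∘ enum E ∘ index E ∘ enum E') ≡⟨ sum≡Σv (g ∘ enum E ∘ index E ∘ enum E') ⟩
  Σv (g ∘ enum E ∘ index E ∘ enum E')      ≡⟨ Σ-cong (cong g ∘ enum-index E ∘ enum E') ⟩
  Σv (g ∘ enum E')                         ∎
  where
  open ≡-Reasoning
  module Sum = MonoidSum +-0-commutativeMonoid
  sum≡Σv : ∀ {k} (f : Fin k → ℕ) → Sum.sum f ≡ Σv f
  sum≡Σv {zero}  f = refl
  sum≡Σv {suc k} f = cong (f zero +_) (sum≡Σv (f ∘ suc))
  π : Perm.Permutation (size E') (size E)
  π = Perm.permutation (index E ∘ enum E') (index E' ∘ enum E)
        (λ i → trans (cong (index E) (enum-index E' (enum E i))) (index-enum E i))
        (λ i → trans (cong (index E') (enum-index E (enum E' i))) (index-enum E' i))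

EFin : ∀ k → Enum (Fin k)
EFin k = record { size = k ; enum = id ; index = id ; enum-index = λ _ → refl ; index-enum = λ _ → refl }

Enum-via : ∀ {A B} → Enum A → (f : A → B) (g : B → A) →
           (∀ a → g (f a) ≡ a) → (∀ b → f (g b) ≡ b) → Enum B
Enum-via E f g gf fg = record
  { size       = size E
  ; enum       = f ∘ enum E
  ; index      = index E ∘ g
  ; enum-index = λ b → trans (cong f (enum-index E (g b))) (fg b)
  ; index-enum = λ i → trans (cong (index E) (gf (enum E i))) (index-enum E i)
  }

module _ {A B : Set} (EA : Enum A) (EB : Enum B) where
  private
    a = size EA
    b = size EB

    split : Fin (a + b) → A ⊎ B
    split i = [ inj₁ ∘ enum EA , inj₂ ∘ enum EB ] (splitAt a i)

    join : A ⊎ B → Fin (a + b)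
    join (inj₁ x) = index EA x ↑ˡ b
    join (inj₂ y) = a ↑ʳ index EB y

    split-join : ∀ z → split (join z) ≡ z
    split-join (inj₁ x) = trans (cong [ inj₁ ∘ enum EA , inj₂ ∘ enum EB ] (splitAt-↑ˡ a (index EA x) b))
                                (cong inj₁ (enum-index EA x))
    split-join (inj₂ y) = trans (cong [ inj₁ ∘ enum EA , inj₂ ∘ enum EB ] (splitAt-↑ʳ a b (index EB y)))
                                (cong inj₂ (enum-index EB y))

    join-split : ∀ i → join (split i) ≡ i
    join-split i with splitAt a i in eq
    ... | inj₁ x = trans (cong (_↑ˡ b) (index-enum EA x))
                         (trans (cong [ _↑ˡ b , a ↑ʳ_ ] (sym eq)) (join-splitAt a b i))
    ... | inj₂ y = trans (cong (a ↑ʳ_) (index-enum EB y))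
                         (trans (cong [ _↑ˡ b , a ↑ʳ_ ] (sym eq)) (join-splitAt a b i))

  E⊎ : Enum (A ⊎ B)
  E⊎ = record { size = a + b ; enum = split ; index = join ; enum-index = split-join ; index-enum = join-split }

  E⊎-sum : ∀ g → ΣE E⊎ g ≡ ΣE EA (g ∘ inj₁) + ΣE EB (g ∘ inj₂)
  E⊎-sum g = trans (Σ-++ a (g ∘ split))
    (cong₂ _+_ (Σ-cong (λ i → cong (g ∘ [ inj₁ ∘ enum EA , inj₂ ∘ enum EB ]) (splitAt-↑ˡ a i b)))
               (Σ-cong (λ j → cong (g ∘ [ inj₁ ∘ enum EA , inj₂ ∘ enum EB ]) (splitAt-↑ʳ a b j))))

module _ {k : ℕ} (B : Fin (suc k) → Set) where
  cons : B zero ⊎ Σ (Fin k) (B ∘ suc) → Σ (Fin (suc k)) B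
  cons (inj₁ x)       = zero , x
  cons (inj₂ (i , x)) = suc i , x

  uncons : Σ (Fin (suc k)) B → B zero ⊎ Σ (Fin k) (B ∘ suc)
  uncons (zero , x)  = inj₁ x
  uncons (suc i , x) = inj₂ (i , x)

  uncons-cons : ∀ z → uncons (cons z) ≡ z
  uncons-cons (inj₁ x)       = refl
  uncons-cons (inj₂ (i , x)) = refl

  cons-uncons : ∀ z → cons (uncons z) ≡ z
  cons-uncons (zero , x)  = refl
  cons-uncons (suc i , x) = refl

-- enumeration of a dependent sum Σ (Fin k) B, fibre after fibre
-- (opaque: only its sum formula EΣ-sum is ever needed, and unfolding the
-- nested enumerations during conversion checking is very expensive)
opaque
  EΣ : ∀ k (B : Fin k → Set) → (∀ i → Enum (B i)) → Enum (Σ (Fin k) B)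
  EΣ zero    B EB = record
    { size = 0 ; enum = λ () ; index = λ { (() , _) } ; enum-index = λ { (() , _) } ; index-enum = λ () }
  EΣ (suc k) B EB =
    Enum-via (E⊎ (EB zero) (EΣ k (B ∘ suc) (EB ∘ suc))) (cons B) (uncons B) (uncons-cons B) (cons-uncons B)

  EΣ-sum : ∀ k (B : Fin k → Set) (EB : ∀ i → Enum (B i)) (h : Σ (Fin k) B → ℕ) →
           ΣE (EΣ k B EB) h ≡ Σv (λ i → ΣE (EB i) (λ x → h (i , x)))
  EΣ-sum zero    B EB h = refl
  EΣ-sum (suc k) B EB h =
    trans (E⊎-sum (EB zero) (EΣ k (B ∘ suc) (EB ∘ suc)) (h ∘ cons B))
          (cong (ΣE (EB zero) (λ x → h (zero , x)) +_)
                (EΣ-sum k (B ∘ suc) (EB ∘ suc) (λ { (i , x) → h (suc i , x) })))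

-- Domination and 3-rainbow total domination for an arbitrary adjacency
-- relation R. For R = Adj G these are literally Dominating and IsRTDF.
Dominates : ∀ {A : Set} → (A → A → Set) → (A → Set) → Set
Dominates {A} R P = ∀ (v : A) → P v ⊎ ∃ λ u → R v u × P u

RainbowTotal : ∀ {A : Set} (k : ℕ) → (A → A → Set) → (A → Subset k) → Set
RainbowTotal {A} k R f =
  (∀ (v : A) → f v ≡ ⊥ → ∀ (i : Fin k) → ∃ λ u → R v u × i ∈ f u) ×
  (∀ (v : A) (i : Fin k) → f v ≡ ⁅ i ⁆ → ∃ λ u → R v u × i ∈ f u)

Dominates-map : ∀ {A} {R : A → A → Set} {P Q : A → Set} →
                (∀ v → P v → Q v) → Dominates R P → Dominates R Q
Dominates-map P⇒Q dom v = ⊎-map (P⇒Q v) (λ { (u , vu , pu) → u , vu , P⇒Q u pu }) (dom v)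

record Iso {A B : Set} (R : A → A → Set) (S : B → B → Set) : Set where
  field
    to        : A → B
    from      : B → A
    from∘to   : ∀ a → from (to a) ≡ a
    to∘from   : ∀ b → to (from b) ≡ b
    preserves : ∀ {a a'} → R a a' → S (to a) (to a')
    reflects  : ∀ {a a'} → S (to a) (to a') → R a a'

module _ {A B : Set} {R : A → A → Set} {S : B → B → Set} (iso : Iso R S) where
  open Iso iso

  Iso-sym : Iso S R
  Iso-sym = record
    { to = from ; from = to ; from∘to = to∘from ; to∘from = from∘to
    ; preserves = λ {b} {b'} s → reflects (subst₂ S (sym (to∘from b)) (sym (to∘from b')) s)
    ; reflects  = λ {b} {b'} r → subst₂ S (to∘from b) (to∘from b') (preserves r)
    }

  neighbour-pull : ∀ a (Q : B → Set) → (∃ λ u → S (to a) u × Q u) → ∃ λ a' → R a a' × Q (to a')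
  neighbour-pull a Q (u , adj , q) =
    from u , reflects (subst (S (to a)) (sym (to∘from u)) adj) , subst Q (sym (to∘from u)) q

  Dominates-pull : ∀ {Q : B → Set} → Dominates S Q → Dominates R (Q ∘ to)
  Dominates-pull {Q} dom a = ⊎-map id (neighbour-pull a Q) (dom (to a))

  RainbowTotal-pull : ∀ {k} {f : B → Subset k} → RainbowTotal k S f → RainbowTotal k R (f ∘ to)
  RainbowTotal-pull {f = f} (empty , single) =
    (λ a e i → neighbour-pull a (λ u → i ∈ f u) (empty (to a) e i)) ,
    (λ a i e → neighbour-pull a (λ u → i ∈ f u) (single (to a) i e))

sum-pull : ∀ {A n} {R : A → A → Set} {S : Fin n → Fin n → Set} (iso : Iso R S) (E : Enum A) →
           ∀ (h : Fin n → ℕ) → Σv h ≡ ΣE E (h ∘ Iso.to iso)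
sum-pull {n = n} iso E h =
  ΣE-unique (EFin n) (Enum-via E (Iso.to iso) (Iso.from iso) (Iso.from∘to iso) (Iso.to∘from iso)) h

sum-push : ∀ {A n} {R : A → A → Set} {S : Fin n → Fin n → Set} (iso : Iso R S) (E : Enum A) →
           ∀ (h : A → ℕ) → Σv (h ∘ Iso.from iso) ≡ ΣE E h
sum-push iso E h = trans (sum-pull iso E (h ∘ Iso.from iso)) (ΣE-cong E (cong h ∘ Iso.from∘to iso))

true≢false : true ≢ false
true≢false ()

true-or-false : ∀ b → b ≡ true ⊎ b ≡ false
true-or-false true  = inj₁ refl
true-or-false false = inj₂ refl

indicator : Bool → ℕ
indicator true  = 1
indicator false = 0

∣∣≡Σ : ∀ {n} (p : Subset n) → ∣ p ∣ ≡ Σv (λ v → indicator (lookup p v))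
∣∣≡Σ []          = refl
∣∣≡Σ (true ∷ p)  = cong suc (∣∣≡Σ p)
∣∣≡Σ (false ∷ p) = ∣∣≡Σ p

∈⇒1≤ : ∀ {n} {p : Subset n} {i} → i ∈ p → 1 ≤ indicator (lookup p i)
∈⇒1≤ i∈p rewrite []=⇒lookup i∈p = s≤s z≤n

count-bound : ∀ {k} (S : Subset k) (h : Fin k → ℕ) → (∀ c → c ∈ S → 1 ≤ h c) → ∣ S ∣ ≤ Σv h
count-bound S h each = subst (_≤ Σv h) (sym (∣∣≡Σ S)) (Σ-mono bound)
  where
  bound : ∀ c → indicator (lookup S c) ≤ h c
  bound c with lookup S c in e
  ... | true  = each c (lookup⇒[]= c S e)
  ... | false = z≤n

-- The neighbourhood of an H-vertex is its
-- partner plus I-vertices, so a demand not met by the partner is met by the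
-- I-side ("supply" la, or one supply value per colour).

pair-domination : ∀ (a b : Bool) (la lb : ℕ) →
                  (a ≡ false → b ≡ true ⊎ 1 ≤ la) → (b ≡ false → a ≡ true ⊎ 1 ≤ lb) →
                  2 ≤ (2 * indicator a + la) + (2 * indicator b + lb)
pair-domination true  b     la lb _  _  = ≤-trans (m≤m+n 2 la) (m≤m+n _ _)
pair-domination false true  la lb _  _  = ≤-trans (m≤m+n 2 lb) (m≤n+m _ la)
pair-domination false false la lb ha hb = +-mono-≤ (supplied (ha refl)) (supplied (hb refl))
  where
  supplied : ∀ {l} → false ≡ true ⊎ 1 ≤ l → 1 ≤ l
  supplied (inj₁ ())
  supplied (inj₂ 1≤l) = 1≤l

Served : Subset 3 → Subset 3 → (Fin 3 → ℕ) → Set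
Served A B supply =
  (A ≡ ⊥ → ∀ c → c ∈ B ⊎ 1 ≤ supply c) × (∀ c → A ≡ ⁅ c ⁆ → c ∈ B ⊎ 1 ≤ supply c)

data LabelView : Subset 3 → Set where
  none : LabelView ⊥
  one  : ∀ c → LabelView ⁅ c ⁆
  many : ∀ {S} → 2 ≤ ∣ S ∣ → LabelView S

label-view : ∀ S → LabelView S
label-view (false ∷ false ∷ false ∷ []) = none
label-view (false ∷ false ∷ true  ∷ []) = one (suc (suc zero))
label-view (false ∷ true  ∷ false ∷ []) = one (suc zero)
label-view (true  ∷ false ∷ false ∷ []) = one zero
label-view (false ∷ true  ∷ true  ∷ []) = many (s≤s (s≤s z≤n))
label-view (true  ∷ false ∷ true  ∷ []) = many (s≤s (s≤s z≤n))
label-view (true  ∷ true  ∷ false ∷ []) = many (s≤s (s≤s z≤n))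
label-view (true  ∷ true  ∷ true  ∷ []) = many (s≤s (s≤s z≤n))

∣∁⁅c⁆∣≡2 : ∀ (c : Fin 3) → ∣ ∁ ⁅ c ⁆ ∣ ≡ 2
∣∁⁅c⁆∣≡2 zero             = refl
∣∁⁅c⁆∣≡2 (suc zero)       = refl
∣∁⁅c⁆∣≡2 (suc (suc zero)) = refl

-- a singleton label next to an empty one: 3 + 1 + 0 + 2
singleton-beside-empty : ∀ c (sa sb : Fin 3 → ℕ) → Served ⁅ c ⁆ ⊥ sa → Served ⊥ ⁅ c ⁆ sb →
                         6 ≤ (3 * ∣ ⁅ c ⁆ ∣ + Σv sa) + (3 * ∣ ⊥ {3} ∣ + Σv sb)
singleton-beside-empty c sa sb (_ , single) (empty , _) =
  +-mono-≤ (+-mono-≤ (*-monoʳ-≤ 3 (≤-reflexive (sym (∣⁅x⁆∣≡1 c)))) c-supplied) others-supplied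
  where
  c-supplied : 1 ≤ Σv sa
  c-supplied = ≤-trans ([ (λ c∈⊥ → ⊥-elim (∉⊥ c∈⊥)) , id ] (single c refl)) (Σ-single sa c)
  others-supplied : 2 ≤ Σv sb
  others-supplied = subst (_≤ Σv sb) (∣∁⁅c⁆∣≡2 c) (count-bound (∁ ⁅ c ⁆) sb λ d d∈∁ →
    [ (λ d∈⁅c⁆ → ⊥-elim (x∈∁p⇒x∉p d∈∁ d∈⁅c⁆)) , id ] (empty refl d))

pair-rainbow : ∀ (A B : Subset 3) (sa sb : Fin 3 → ℕ) → Served A B sa → Served B A sb →
               6 ≤ (3 * ∣ A ∣ + Σv sa) + (3 * ∣ B ∣ + Σv sb)
pair-rainbow A B sa sb servedA servedB with label-view A | label-view B
... | many 2≤∣A∣ | _ =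
  ≤-trans (*-monoʳ-≤ 3 2≤∣A∣) (≤-trans (m≤m+n (3 * ∣ A ∣) (Σv sa)) (m≤m+n _ (3 * ∣ B ∣ + Σv sb)))
... | _ | many 2≤∣B∣ =
  ≤-trans (*-monoʳ-≤ 3 2≤∣B∣) (≤-trans (m≤m+n (3 * ∣ B ∣) (Σv sb)) (m≤n+m _ (3 * ∣ A ∣ + Σv sa)))
... | one c | one c' = +-mono-≤ (≤-trans (*-monoʳ-≤ 3 (≤-reflexive (sym (∣⁅x⁆∣≡1 c)))) (m≤m+n _ _))
                                 (≤-trans (*-monoʳ-≤ 3 (≤-reflexive (sym (∣⁅x⁆∣≡1 c')))) (m≤m+n _ _))
... | one c | none  = singleton-beside-empty c sa sb servedA servedB
... | none  | one c = subst (6 ≤_) (+-comm (3 * ∣ ⁅ c ⁆ ∣ + Σv sb) (Σv sa))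
                            (singleton-beside-empty c sb sa servedB servedA)
... | none  | none  = +-mono-≤ (all-supplied sa servedA) (all-supplied sb servedB)
  where
  all-supplied : ∀ supply → Served ⊥ ⊥ supply → 3 ≤ Σv supply
  all-supplied supply (empty , _) =
    count-bound ⊤ supply λ c _ → [ (λ c∈⊥ → ⊥-elim (∉⊥ c∈⊥)) , id ] (empty refl c)

module Model (m : ℕ) (s : Triple m → ℕ) where

  Point : Set
  Point = Fin m × Fin 2

  V : Set
  V = TVertex m s

  EP : Enum Point
  EP = EΣ m (λ _ → Fin 2) (λ _ → EFin 2)

  EP-sum : ∀ (h : Point → ℕ) → ΣE EP h ≡ Σv (λ j → Σv (λ b → h (j , b)))
  EP-sum h = EΣ-sum m (λ _ → Fin 2) (λ _ → EFin 2) h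

  all-or-counterexampleᴾ : ∀ {P Q : Point → Set} → (∀ p → P p ⊎ Q p) → (∀ p → P p) ⊎ ∃ Q
  all-or-counterexampleᴾ {P} {Q} d =
    ⊎-map (λ all (j , b) → all j b) (λ (j , b , q) → (j , b) , q)
          (all-or-counterexample {P = λ j → ∀ b → P (j , b)} {Q = λ j → ∃ λ b → Q (j , b)}
                                 λ j → all-or-counterexample λ b → d (j , b))

  edges-bound : ∀ (h : Point → ℕ) {c} → (∀ j → c ≤ h (j , zero) + h (j , suc zero)) → m * c ≤ ΣE EP h
  edges-bound h {c} each = subst (_≤ ΣE EP h) (Σ-const {m} c)
    (≤-trans (Σ-mono (λ j → subst (c ≤_) (cong (h (j , zero) +_) (sym (+-identityʳ _))) (each j)))
             (≤-reflexive (sym (EP-sum h))))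

  edges-constant : ∀ (h : Point → ℕ) {c} → (∀ j → h (j , zero) + h (j , suc zero) ≡ c) → ΣE EP h ≡ m * c
  edges-constant h {c} each =
    trans (EP-sum h) (trans (Σ-cong (λ j → trans (cong (h (j , zero) +_) (+-identityʳ _)) (each j)))
                            (Σ-const {m} c))

  EΣP : (B : Point → Set) → (∀ p → Enum (B p)) → Enum (Σ Point B)
  EΣP B EB = Enum-via (EΣ m _ λ j → EΣ 2 _ λ b → EB (j , b))
                      (λ (j , b , y) → (j , b) , y) (λ ((j , b) , y) → j , b , y)
                      (λ _ → refl) (λ _ → refl)

  EΣP-sum : ∀ (B : Point → Set) (EB : ∀ p → Enum (B p)) (h : Σ Point B → ℕ) →
            ΣE (EΣP B EB) h ≡ ΣE EP (λ p → ΣE (EB p) (λ y → h (p , y)))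
  EΣP-sum B EB h =
    trans (EΣ-sum m _ (λ j → EΣ 2 _ λ b → EB (j , b)) (λ (j , b , y) → h ((j , b) , y)))
          (trans (Σ-cong (λ j → EΣ-sum 2 _ (λ b → EB (j , b)) (λ (b , y) → h ((j , b) , y))))
                 (sym (EP-sum (λ p → ΣE (EB p) (λ y → h (p , y))))))

  EH : Enum (HVertex m)
  EH = EΣ 3 (λ _ → Point) (λ _ → EP)

  INested : Set
  INested = Σ Point λ x₁ → Σ Point λ x₂ → Σ Point λ x₃ → Fin (s (x₁ , x₂ , x₃))

  EINested : Enum INested
  EINested = EΣP _ λ x₁ → EΣP _ λ x₂ → EΣP _ λ x₃ → EFin (s (x₁ , x₂ , x₃))

  unnest : INested → Σ (Triple m) (λ x → Fin (s x))
  unnest (x₁ , x₂ , x₃ , k) = (x₁ , x₂ , x₃) , k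

  nest : Σ (Triple m) (λ x → Fin (s x)) → INested
  nest ((x₁ , x₂ , x₃) , k) = x₁ , x₂ , x₃ , k

  EI : Enum (Σ (Triple m) (λ x → Fin (s x)))
  EI = Enum-via EINested unnest nest (λ _ → refl) (λ _ → refl)

  EV : Enum V
  EV = E⊎ EH EI

  weightH : Fin 3 → (V → ℕ) → ℕ
  weightH i g = ΣE EP (λ p → g (inj₁ (i , p)))

  weightH-constant : ∀ i (g : V → ℕ) {c} →
                     (∀ j → g (inj₁ (i , j , zero)) + g (inj₁ (i , j , suc zero)) ≡ c) → weightH i g ≡ m * c
  weightH-constant i g = edges-constant (λ p → g (inj₁ (i , p)))

  weightI : (V → ℕ) → ℕ
  weightI g = ΣE EP λ x₁ → ΣE EP λ x₂ → ΣE EP λ x₃ → Σv λ k → g (inj₂ ((x₁ , x₂ , x₃) , k))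

  EINested-sum : ∀ (h : INested → ℕ) →
                 ΣE EINested h ≡ ΣE EP λ x₁ → ΣE EP λ x₂ → ΣE EP λ x₃ → Σv λ k → h (x₁ , x₂ , x₃ , k)
  EINested-sum h =
    trans (EΣP-sum _ _ h) (ΣE-cong EP λ x₁ →
    trans (EΣP-sum (λ x₂ → Σ Point λ x₃ → Fin (s (x₁ , x₂ , x₃)))
                   (λ x₂ → EΣP _ λ x₃ → EFin (s (x₁ , x₂ , x₃))) (λ y → h (x₁ , y)))
          (ΣE-cong EP λ x₂ →
    EΣP-sum (λ x₃ → Fin (s (x₁ , x₂ , x₃))) (λ x₃ → EFin (s (x₁ , x₂ , x₃))) (λ y → h (x₁ , x₂ , y))))

  total-split : ∀ g → ΣE EV g ≡ Σv (λ i → weightH i g) + weightI g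
  total-split g =
    trans (E⊎-sum EH EI g)
          (cong₂ _+_ (EΣ-sum 3 (λ _ → Point) (λ _ → EP) (g ∘ inj₁)) (EINested-sum (g ∘ inj₂ ∘ unnest)))

  weightI-vanishing : ∀ g → (∀ x k → g (inj₂ (x , k)) ≡ 0) → weightI g ≡ 0
  weightI-vanishing g zero-on-I =
    trans (ΣE-cong EP λ x₁ → trans (ΣE-cong EP λ x₂ → trans (ΣE-cong EP λ x₃ →
      trans (Σ-cong (zero-on-I (x₁ , x₂ , x₃))) (Σ-zero (s (x₁ , x₂ , x₃))))
      (ΣE-zero EP)) (ΣE-zero EP)) (ΣE-zero EP)

  total-from-edges : ∀ g (c : Fin 3 → ℕ) →
                     (∀ i j → g (inj₁ (i , j , zero)) + g (inj₁ (i , j , suc zero)) ≡ c i) →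
                     (∀ x k → g (inj₂ (x , k)) ≡ 0) → ΣE EV g ≡ m * Σv c
  total-from-edges g c edges zero-on-I = begin
    ΣE EV g                                  ≡⟨ total-split g ⟩
    Σv (λ i → weightH i g) + weightI g       ≡⟨ cong₂ _+_ (Σ-cong λ i → weightH-constant i g (edges i))
                                                          (weightI-vanishing g zero-on-I) ⟩
    Σv (λ i → m * c i) + 0                   ≡⟨ +-identityʳ _ ⟩
    Σv (λ i → m * c i)                       ≡⟨ Σ-* m c ⟩
    m * Σv c                                 ∎
    where open ≡-Reasoning

  slot : Fin 3 → Point → Point → Point → Triple m
  slot zero             p a b = p , a , b
  slot (suc zero)       p a b = a , p , b
  slot (suc (suc zero)) p a b = a , b , p

  triple : (Fin 3 → Point) → Triple m
  triple z = z zero , z (suc zero) , z (suc (suc zero))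

  comp-triple : ∀ z i → comp (triple z) i ≡ z i
  comp-triple z zero             = refl
  comp-triple z (suc zero)       = refl
  comp-triple z (suc (suc zero)) = refl

  load : Fin 3 → (V → ℕ) → Point → ℕ
  load i g p = ΣE EP λ a → ΣE EP λ b → Σv λ k → g (inj₂ (slot i p a b , k))

  -- double counting: each triple has exactly one vertex in slot i
  load-double-count : ∀ i g → ΣE EP (load i g) ≡ weightI g
  load-double-count zero             g = refl
  load-double-count (suc zero)       g =
    ΣE-swap EP EP (λ p a → ΣE EP λ b → Σv λ k → g (inj₂ ((a , p , b) , k)))
  load-double-count (suc (suc zero)) g =
    trans (ΣE-swap EP EP (λ p a → ΣE EP λ b → Σv λ k → g (inj₂ ((a , b , p) , k))))
          (ΣE-cong EP λ a → ΣE-swap EP EP (λ p b → Σv λ k → g (inj₂ ((a , b , p) , k))))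

  load-I-set : ∀ i g p a b → Σv (λ k → g (inj₂ (slot i p a b , k))) ≤ load i g p
  load-I-set i g p a b =
    ≤-trans (ΣE-single EP (λ b → Σv λ k → g (inj₂ (slot i p a b , k))) b)
            (ΣE-single EP (λ a → ΣE EP λ b → Σv λ k → g (inj₂ (slot i p a b , k))) a)

  load-triple : ∀ i g x → Σv (λ k → g (inj₂ (x , k))) ≤ load i g (comp x i)
  load-triple zero             g (x₁ , x₂ , x₃) = load-I-set zero g x₁ x₂ x₃
  load-triple (suc zero)       g (x₁ , x₂ , x₃) = load-I-set (suc zero) g x₂ x₁ x₃
  load-triple (suc (suc zero)) g (x₁ , x₂ , x₃) = load-I-set (suc (suc zero)) g x₃ x₁ x₂

  load-vertex : ∀ i g x k → g (inj₂ (x , k)) ≤ load i g (comp x i)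
  load-vertex i g x k = ≤-trans (Σ-single (λ k → g (inj₂ (x , k))) k) (load-triple i g x)

  supplied : ∀ i g {x k p} → comp x i ≡ p → 1 ≤ g (inj₂ (x , k)) → 1 ≤ load i g p
  supplied i g {x} {k} xᵢ≡p pos =
    ≤-trans pos (subst (λ q → g (inj₂ (x , k)) ≤ load i g q) xᵢ≡p (load-vertex i g x k))

  load-cong : ∀ i {f g : V → ℕ} → (∀ t → f t ≡ g t) → ∀ p → load i f p ≡ load i g p
  load-cong i e p = ΣE-cong EP λ a → ΣE-cong EP λ b → Σ-cong λ k → e (inj₂ (slot i p a b , k))

  load-Σ : ∀ {r} i (G : Fin r → V → ℕ) p →
           load i (λ t → Σv (λ c → G c t)) p ≡ Σv (λ c → load i (G c) p)
  load-Σ {r} i G p =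
    trans (ΣE-cong EP (λ a → trans (ΣE-cong EP (λ b → Σ-swap (λ k c → G' a b c k)))
                                   (ΣE-swap EP (EFin r) (λ b c → Σv (G' a b c)))))
          (ΣE-swap EP (EFin r) (λ a c → ΣE EP λ b → Σv (G' a b c)))
    where
    G' : (a b : Point) (c : Fin r) → Fin (s (slot i p a b)) → ℕ
    G' a b c k = G c (inj₂ (slot i p a b , k))

  local-weight : ℕ → (V → ℕ) → Fin 3 → Point → ℕ
  local-weight c g i p = c * g (inj₁ (i , p)) + load i g p

  local-sum : ∀ i c g → ΣE EP (local-weight c g i) ≡ c * weightH i g + weightI g
  local-sum i c g =
    trans (ΣE-+ EP (λ p → c * g (inj₁ (i , p))) (load i g))
          (cong₂ _+_ (ΣE-* EP c (λ p → g (inj₁ (i , p)))) (load-double-count i g))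

  partner : Fin 2 → Fin 2
  partner zero       = suc zero
  partner (suc zero) = zero

  partner-≢ : ∀ b → b ≢ partner b
  partner-≢ zero       ()
  partner-≢ (suc zero) ()

  partner-unique : ∀ {b b'} → b ≢ b' → b' ≡ partner b
  partner-unique {zero}     {zero}     b≢b' = ⊥-elim (b≢b' refl)
  partner-unique {zero}     {suc zero} b≢b' = refl
  partner-unique {suc zero} {zero}     b≢b' = refl
  partner-unique {suc zero} {suc zero} b≢b' = ⊥-elim (b≢b' refl)

  partner-or-I : ∀ {i j b} (Q : V → Set) → (∃ λ t → TAdj (inj₁ (i , j , b)) t × Q t) →
                 Q (inj₁ (i , j , partner b)) ⊎ ∃₂ λ x k → comp x i ≡ (j , b) × Q (inj₂ (x , k))
  partner-or-I {i} {j} {b} Q (inj₁ (_ , _ , b') , (refl , refl , b≢b') , q) =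
    inj₁ (subst (λ c → Q (inj₁ (i , j , c))) (partner-unique b≢b') q)
  partner-or-I Q (inj₂ (x , k) , xᵢ≡p , q) = inj₂ (x , k , xᵢ≡p , q)

  I-neighbour : ∀ {x k} (Q : V → Set) → (∃ λ t → TAdj (inj₂ (x , k)) t × Q t) →
                ∃ λ i → Q (inj₁ (i , comp x i))
  I-neighbour Q (inj₁ (i , _) , refl , q) = i , q

  module DominationLowerBound (m≥2 : 2 ≤ m) (s≥m : ∀ x → m ≤ s x)
                              (D : V → Bool) (dom : Dominates TAdj (λ t → D t ≡ true)) where

    δ : V → ℕ
    δ = indicator ∘ D

    H-dominated : ∀ i j b → D (inj₁ (i , j , b)) ≡ false →
                  D (inj₁ (i , j , partner b)) ≡ true ⊎ 1 ≤ load i δ (j , b)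
    H-dominated i j b out with dom (inj₁ (i , j , b))
    ... | inj₁ inside = ⊥-elim (true≢false (trans (sym inside) out))
    ... | inj₂ nb =
      ⊎-map id (λ (x , k , xᵢ≡p , inside) → supplied i δ xᵢ≡p (≤-reflexive (sym (cong indicator inside))))
               (partner-or-I (λ t → D t ≡ true) nb)

    edge-bound : ∀ i → m * 2 ≤ 2 * weightH i δ + weightI δ
    edge-bound i = subst (m * 2 ≤_) (local-sum i 2 δ)
      (edges-bound (local-weight 2 δ i) λ j →
         pair-domination _ _ _ _ (H-dominated i j zero) (H-dominated i j (suc zero)))

    I-set-inside : ∀ x → (∀ i → D (inj₁ (i , comp x i)) ≡ false) → ∀ k → D (inj₂ (x , k)) ≡ true
    I-set-inside x outside k with dom (inj₂ (x , k))
    ... | inj₁ inside = inside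
    ... | inj₂ nb with I-neighbour (λ t → D t ≡ true) nb
    ...   | i , inside = ⊥-elim (true≢false (trans (sym inside) (outside i)))

    I-set-large : ∀ x → (∀ i → D (inj₁ (i , comp x i)) ≡ false) → 2 ≤ Σv (λ k → δ (inj₂ (x , k)))
    I-set-large x outside = ≤-trans m≥2 (≤-trans (s≥m x) (≤-reflexive (sym I-set-size)))
      where
      I-set-size : Σv (λ k → δ (inj₂ (x , k))) ≡ s x
      I-set-size = trans (Σ-cong (λ k → cong indicator (I-set-inside x outside k)))
                         (trans (Σ-const {s x} 1) (*-identityʳ (s x)))

    -- if every Hᵢ has a vertex y i outside D then 2dᵢ + X ≥ 4m: a vertex p ∉ D
    -- of Hᵢ lies on the triple y[i ↦ p], which avoids D
    vertex-bound : (y : Fin 3 → Point) → (∀ i → D (inj₁ (i , y i)) ≡ false) →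
                   ∀ i → m * 4 ≤ 2 * weightH i δ + weightI δ
    vertex-bound y outside i = subst (m * 4 ≤_) (local-sum i 2 δ)
      (edges-bound (local-weight 2 δ i) λ j → +-mono-≤ (local (j , zero)) (local (j , suc zero)))
      where
      local : ∀ p → 2 ≤ 2 * δ (inj₁ (i , p)) + load i δ p
      local p with D (inj₁ (i , p)) in p∉D
      ... | true  = m≤m+n 2 _
      ... | false = ≤-trans (I-set-large x x-outside)
                            (subst (λ q → Σv (λ k → δ (inj₂ (x , k))) ≤ load i δ q) xᵢ≡p (load-triple i δ x))
        where
        z : Fin 3 → Point
        z = updateAt y i (λ _ → p)
        x : Triple m
        x = triple z
        xᵢ≡p : comp x i ≡ p
        xᵢ≡p = trans (comp-triple z i) (updateAt-updates i y)
        x-outside : ∀ j → D (inj₁ (j , comp x j)) ≡ false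
        x-outside j with j ≟ i
        ... | yes refl = subst (λ q → D (inj₁ (j , q)) ≡ false) (sym xᵢ≡p) p∉D
        ... | no j≢i   = subst (λ q → D (inj₁ (j , q)) ≡ false)
                               (sym (trans (comp-triple z j) (updateAt-minimal j i y j≢i))) (outside j)

    -- if Hᵢ ⊆ D then dᵢ = 2m, and averaging the other two edge bounds gives 2m more
    full-bound : ∀ i → (∀ p → D (inj₁ (i , p)) ≡ true) → m * 4 ≤ Σv (λ i → weightH i δ) + weightI δ
    full-bound i full with Σ3-split (λ i → weightH i δ) i
    ... | j , k , split = begin
      m * 4                                       ≡⟨ double m ⟩
      m * 2 + m * 2                               ≤⟨ +-mono-≤ (≤-reflexive (sym Hᵢ-weight))
                                                              (averaging₂ {d j} {d k} (edge-bound j) (edge-bound k)) ⟩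
      d i + (d j + d k + weightI δ)               ≡⟨ +-assoc (d i) (d j + d k) (weightI δ) ⟨
      d i + (d j + d k) + weightI δ               ≡⟨ cong (_+ weightI δ) split ⟨
      Σv (λ i → weightH i δ) + weightI δ          ∎
      where
      open Data.Nat.Properties.≤-Reasoning
      d : Fin 3 → ℕ
      d i = weightH i δ
      double : ∀ m → m * 4 ≡ m * 2 + m * 2
      double = solve-∀
      Hᵢ-weight : d i ≡ m * 2
      Hᵢ-weight = weightH-constant i δ λ j →
        cong₂ (λ u v → indicator u + indicator v) (full (j , zero)) (full (j , suc zero))

    domination-lower-bound : m * 4 ≤ ΣE EV δ
    domination-lower-bound = subst (m * 4 ≤_) (sym (total-split δ))
                               (by-cases (all-or-counterexample λ i → swap (Hᵢ-full-or-not i)))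
      where
      Hᵢ-full-or-not : ∀ i → (∀ p → D (inj₁ (i , p)) ≡ true) ⊎ ∃ λ p → D (inj₁ (i , p)) ≡ false
      Hᵢ-full-or-not i = all-or-counterexampleᴾ λ p → true-or-false (D (inj₁ (i , p)))
      by-cases : (∀ i → ∃ λ p → D (inj₁ (i , p)) ≡ false) ⊎ (∃ λ i → ∀ p → D (inj₁ (i , p)) ≡ true) →
                 m * 4 ≤ Σv (λ i → weightH i δ) + weightI δ
      by-cases (inj₂ (i , full)) = full-bound i full
      by-cases (inj₁ outside) =
        ≤-trans (averaging₂ {weightH zero δ} {weightH (suc zero) δ}
                            (vertex-bound y (proj₂ ∘ outside) zero) (vertex-bound y (proj₂ ∘ outside) (suc zero)))
                (+-monoˡ-≤ (weightI δ) (+-monoʳ-≤ (weightH zero δ)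
                  (m≤m+n (weightH (suc zero) δ) (weightH (suc (suc zero)) δ + 0))))
        where
        y : Fin 3 → Point
        y = proj₁ ∘ outside

  module RainbowLowerBound (F : V → Subset 3) (rainbow : RainbowTotal 3 TAdj F) where

    w : V → ℕ
    w t = ∣ F t ∣

    χ : Fin 3 → V → ℕ
    χ c t = indicator (lookup (F t) c)

    colour-supplied : ∀ i j b c → (∃ λ t → TAdj (inj₁ (i , j , b)) t × c ∈ F t) →
                      c ∈ F (inj₁ (i , j , partner b)) ⊎ 1 ≤ load i (χ c) (j , b)
    colour-supplied i j b c nb =
      ⊎-map id (λ (x , k , xᵢ≡p , c∈) → supplied i (χ c) xᵢ≡p (∈⇒1≤ c∈)) (partner-or-I (λ t → c ∈ F t) nb)

    served : ∀ i j b →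
             Served (F (inj₁ (i , j , b))) (F (inj₁ (i , j , partner b))) (λ c → load i (χ c) (j , b))
    served i j b = (λ empty c → colour-supplied i j b c (proj₁ rainbow _ empty c))
                 , (λ c single → colour-supplied i j b c (proj₂ rainbow _ c single))

    load-by-colour : ∀ i p → load i w p ≡ Σv (λ c → load i (χ c) p)
    load-by-colour i p = trans (load-cong i (λ t → ∣∣≡Σ (F t)) p) (load-Σ i χ p)

    edge-bound : ∀ i → m * 6 ≤ 3 * weightH i w + weightI w
    edge-bound i = subst (m * 6 ≤_) (local-sum i 3 w) (edges-bound (local-weight 3 w i) λ j →
      subst (6 ≤_) (cong₂ (λ u v → (3 * w (inj₁ (i , j , zero)) + u) + (3 * w (inj₁ (i , j , suc zero)) + v))
                          (sym (load-by-colour i (j , zero))) (sym (load-by-colour i (j , suc zero))))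
                   (pair-rainbow _ _ _ _ (served i j zero) (served i j (suc zero))))

    rainbow-lower-bound : m * 6 ≤ ΣE EV w
    rainbow-lower-bound =
      subst (m * 6 ≤_) (sym (total-split w)) (averaging 2 (λ i → weightH i w) edge-bound)

  D₀ : V → Bool
  D₀ (inj₁ (zero , _))               = true
  D₀ (inj₁ (suc _ , _ , zero))       = true
  D₀ (inj₁ (suc _ , _ , suc zero))   = false
  D₀ (inj₂ _)                        = false

  D₀-dominates : Dominates TAdj (λ t → D₀ t ≡ true)
  D₀-dominates (inj₁ (zero , p))             = inj₁ refl
  D₀-dominates (inj₁ (suc i , j , zero))     = inj₁ refl
  D₀-dominates (inj₁ (suc i , j , suc zero)) = inj₂ (inj₁ (suc i , j , zero) , (refl , refl , λ ()) , refl)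
  D₀-dominates (inj₂ (x , k))                = inj₂ (inj₁ (zero , comp x zero) , refl , refl)

  D₀-size : ΣE EV (indicator ∘ D₀) ≡ m * 4
  D₀-size = total-from-edges (indicator ∘ D₀) (λ { zero → 2 ; (suc _) → 1 })
    (λ { zero _ → refl ; (suc zero) _ → refl ; (suc (suc zero)) _ → refl }) (λ _ _ → refl)

  F₀ : V → Subset 3
  F₀ (inj₁ (i , _)) = ⁅ i ⁆
  F₀ (inj₂ _)       = ⊥

  F₀-rainbow : RainbowTotal 3 TAdj F₀
  F₀-rainbow = empty , single
    where
    empty : ∀ t → F₀ t ≡ ⊥ → ∀ c → ∃ λ u → TAdj t u × c ∈ F₀ u
    empty (inj₁ (i , _)) ⁅i⁆≡⊥ c = ⊥-elim (∉⊥ (subst (i ∈_) ⁅i⁆≡⊥ (x∈⁅x⁆ i)))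
    empty (inj₂ (x , k)) _     c = inj₁ (c , comp x c) , refl , x∈⁅x⁆ c
    single : ∀ t c → F₀ t ≡ ⁅ c ⁆ → ∃ λ u → TAdj t u × c ∈ F₀ u
    single (inj₁ (i , j , b)) c ⁅i⁆≡⁅c⁆ =
      inj₁ (i , j , partner b) , (refl , refl , partner-≢ b) , subst (c ∈_) (sym ⁅i⁆≡⁅c⁆) (x∈⁅x⁆ c)
    single (inj₂ _) c ⊥≡⁅c⁆ = ⊥-elim (∉⊥ (subst (c ∈_) (sym ⊥≡⁅c⁆) (x∈⁅x⁆ c)))

  F₀-weight : ΣE EV (∣_∣ ∘ F₀) ≡ m * 6
  F₀-weight = total-from-edges (∣_∣ ∘ F₀) (λ _ → 2)
    (λ { zero _ → refl ; (suc zero) _ → refl ; (suc (suc zero)) _ → refl }) (λ _ _ → refl)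

module _ {m n} {s : Triple m → ℕ} (G : Graph n) (iso : Iso (TAdj {m} {s}) (Adj G)) where
  open Model m s
  open Iso iso

  domination-number : 2 ≤ m → (∀ x → m ≤ s x) → ∀ {g} → IsDominationNumber G g → g ≡ m * 4
  domination-number m≥2 s≥m {g} ((D , D-dominates , ∣D∣≡g) , minimal) = ≤-antisym upper lower
    where
    open Data.Nat.Properties.≤-Reasoning
    lower : m * 4 ≤ g
    lower = begin
      m * 4                              ≤⟨ DominationLowerBound.domination-lower-bound m≥2 s≥m (lookup D ∘ to)
                                              (Dominates-pull iso (Dominates-map (λ _ → []=⇒lookup) D-dominates)) ⟩
      ΣE EV (indicator ∘ lookup D ∘ to)   ≡⟨ sum-pull iso EV (indicator ∘ lookup D) ⟨
      Σv (indicator ∘ lookup D)           ≡⟨ ∣∣≡Σ D ⟨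
      ∣ D ∣                               ≡⟨ ∣D∣≡g ⟩
      g                                  ∎
    D₀ᴳ : Subset n
    D₀ᴳ = tabulate (D₀ ∘ from)
    D₀ᴳ-dominates : Dominating G D₀ᴳ
    D₀ᴳ-dominates = Dominates-map (λ v e → lookup⇒[]= v D₀ᴳ (trans (lookup∘tabulate (D₀ ∘ from) v) e))
                                  (Dominates-pull (Iso-sym iso) D₀-dominates)
    upper : g ≤ m * 4
    upper = begin
      g                                  ≤⟨ minimal D₀ᴳ D₀ᴳ-dominates ⟩
      ∣ D₀ᴳ ∣                             ≡⟨ ∣∣≡Σ D₀ᴳ ⟩
      Σv (indicator ∘ lookup D₀ᴳ)         ≡⟨ Σ-cong (cong indicator ∘ lookup∘tabulate (D₀ ∘ from)) ⟩
      Σv (indicator ∘ D₀ ∘ from)          ≡⟨ sum-push iso EV (indicator ∘ D₀) ⟩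
      ΣE EV (indicator ∘ D₀)              ≡⟨ D₀-size ⟩
      m * 4                              ∎

  rainbow-number : ∀ {r} → IsRTDNumber 3 G r → r ≡ m * 6
  rainbow-number {r} ((f , f-rainbow , weight≡r) , minimal) = ≤-antisym upper lower
    where
    open Data.Nat.Properties.≤-Reasoning
    lower : m * 6 ≤ r
    lower = begin
      m * 6                  ≤⟨ RainbowLowerBound.rainbow-lower-bound (f ∘ to) (RainbowTotal-pull iso f-rainbow) ⟩
      ΣE EV (∣_∣ ∘ f ∘ to)    ≡⟨ sum-pull iso EV (∣_∣ ∘ f) ⟨
      weight f               ≡⟨ weight≡r ⟩
      r                      ∎
    upper : r ≤ m * 6
    upper = begin
      r                      ≤⟨ minimal (F₀ ∘ from) (RainbowTotal-pull (Iso-sym iso) F₀-rainbow) ⟩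
      weight (F₀ ∘ from)     ≡⟨ sum-push iso EV (∣_∣ ∘ F₀) ⟩
      ΣE EV (∣_∣ ∘ F₀)        ≡⟨ F₀-weight ⟩
      m * 6                  ∎

model-iso : ∀ {m n} (G : Graph n) (s : Triple m → ℕ) (φ : TVertex m s → Fin n) →
            Bijective _≡_ _≡_ φ → (∀ a b → TAdj a b ⇔ Adj G (φ a) (φ b)) → Iso (TAdj {m} {s}) (Adj G)
model-iso G s φ (injective , surjective) adj = record
  { to = φ ; from = ψ ; from∘to = ψ∘φ ; to∘from = φ∘ψ
  ; preserves = λ {a} {b} → Equivalence.to (adj a b)
  ; reflects  = λ {a} {b} → Equivalence.from (adj a b)
  }
  where
  ψ : Fin _ → TVertex _ s
  ψ v = proj₁ (surjective v)
  φ∘ψ : ∀ v → φ (ψ v) ≡ v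
  φ∘ψ v = proj₂ (surjective v) refl
  ψ∘φ : ∀ a → ψ (φ a) ≡ a
  ψ∘φ a = injective (φ∘ψ (φ a))

proposition11 : ∀ (m : ℕ) → 2 ≤ m → ∀ (n : ℕ) (G : Graph n) → InT m G →
                  ∀ (g r : ℕ) → IsDominationNumber G g → IsRTDNumber 3 G r →
                  2 * r ≡ 3 * g
proposition11 m m≥2 n G (s , s≥m , φ , φ-bijective , φ-adjacency) g r γ-is-g γ3rt-is-r = begin
  2 * r        ≡⟨ cong (2 *_) (rainbow-number G iso γ3rt-is-r) ⟩
  2 * (m * 6)  ≡⟨ six-to-four m ⟩
  3 * (m * 4)  ≡⟨ cong (3 *_) (domination-number G iso m≥2 s≥m γ-is-g) ⟨
  3 * g        ∎
  where
  open ≡-Reasoning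
  iso : Iso (TAdj {m} {s}) (Adj G)
  iso = model-iso G s φ φ-bijective φ-adjacency
  six-to-four : ∀ m → 2 * (m * 6) ≡ 3 * (m * 4)
  six-to-four = solve-∀
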